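{- Let $S$ be a set equipped with a well-founded order $\prec$, and let $\mathcal{I}$ be an inference system on $S$ in which every rule that is not an introduction rule has each of its premises tagged as major or minor. Then a proof in $\mathcal{I}$ is cut-free if and only if every rule used in it is an introduction rule.
   Context: An inference rule on $S$ is a partial function $R$ from finite lists of elements of $S$ to $S$; if $s=R(s_1,\dots,s_n)$ we say $s$ is proved from the premises $s_1,\dots,s_n$ by $R$. An inference system is a set of inference rules. A proof is a finite tree whose nodes are labeled by elements of $S$ and annotated by rules of the system, such that at each node labeled $s$ with children labeled $s_1,\dots,s_n$ the annotated rule $R$ satisfies $s=R(s_1,\dots,s_n)$. A rule $R$ is an introduction rule (with respect to $\prec$) if whenever $s=R(s_1,\dots,s_n)$ we have $s_i\prec s$ for all $i$. A (general) cut is a proof whose last rule is a non-introduction rule and in which each sub-proof of a major premise of this last rule ends with (has as its last rule) an introduction rule; the sub-proofs of the minor premises are arbitrary. A proof contains a cut if one of its sub-proofs is a cut, and is cut-free if it contains no cut. -}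

module Defs where

open import Data.Bool using (Bool; true)
open import Data.Fin using (Fin; zero; suc)
open import Data.List using (List; []; _∷_; length; lookup)
open import Data.List.Relation.Unary.All using (All; []; _∷_)
open import Data.Maybe using (Maybe; just)
open import Data.Product using (_×_)
open import Relation.Binary.PropositionalEquality using (_≡_)
open import Relation.Nullary using (¬_)

Rule : Set → Set
Rule S = List S → Maybe S

IsIntro : {S : Set} → (S → S → Set) → Rule S → Set
IsIntro _≺_ R = ∀ ss s → R ss ≡ just s → All (λ sᵢ → sᵢ ≺ s) ss

nth : {A : Set} {P : A → Set} {xs : List A} → All P xs → (k : Fin (length xs)) → P (lookup xs k)
nth (px ∷ _)  zero    = px
nth (_ ∷ pxs) (suc k) = nth pxs k

data Proof {S : Set} {I : Set} (rule : I → Rule S) : S → Set where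
  node : (i : I) (ss : List S) {s : S} → rule i ss ≡ just s → All (Proof rule) ss → Proof rule s

lastRule : {S I : Set} {rule : I → Rule S} {s : S} → Proof rule s → I
lastRule (node i _ _ _) = i

-- The tagging of premises: major i ss k ≡ true means that, when rule i is applied to
-- the premise list ss, the k-th premise is major (otherwise minor).  It is only
-- consulted for non-introduction rules.
module System {S : Set} (_≺_ : S → S → Set) {I : Set} (rule : I → Rule S)
               (major : (i : I) (ss : List S) → Fin (length ss) → Bool) where

  EndsWithIntro : {s : S} → Proof rule s → Set
  EndsWithIntro p = IsIntro _≺_ (rule (lastRule p))

  IsCut : {s : S} → Proof rule s → Set
  IsCut (node i ss _ ps) =
    ¬ IsIntro _≺_ (rule i) × (∀ k → major i ss k ≡ true → EndsWithIntro (nth ps k))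

  data ContainsCut : {s : S} → Proof rule s → Set where
    here  : ∀ {s} {p : Proof rule s} → IsCut p → ContainsCut p
    there : ∀ {s} i ss (e : rule i ss ≡ just s) (ps : All (Proof rule) ss) (k : Fin (length ss)) →
            ContainsCut (nth ps k) → ContainsCut (node i ss e ps)

  CutFree : {s : S} → Proof rule s → Set
  CutFree p = ¬ ContainsCut p

  data OnlyIntro : {s : S} → Proof rule s → Set where
    onlyIntro : ∀ {s} i ss (e : rule i ss ≡ just s) (ps : All (Proof rule) ss) →
                IsIntro _≺_ (rule i) → (∀ k → OnlyIntro (nth ps k)) →
                OnlyIntro (node i ss e ps)

module Submission where

-- A proof that uses only introduction rules contains no cut, since
-- every cut ends with a non-introduction rule.  Conversely, let p be
-- cut-free.  Each immediate sub-proof is cut-free, so by induction it uses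
-- only introduction rules; in particular each sub-proof ends with an
-- introduction rule.  If the last rule of p were not an introduction rule,
-- then all its major premises would be proved by sub-proofs ending with an
-- introduction rule, so p itself would be a cut.  Hence (classically) the
-- last rule of p is an introduction rule.

open import Defs
open import Data.Bool using (Bool)
open import Data.Fin using (Fin; zero; suc)
open import Data.List using (List; length; _∷_)
open import Data.List.Relation.Unary.All using (All; _∷_)
open import Data.Maybe using (just)
open import Data.Product using (_,_)
open import Relation.Binary.PropositionalEquality using (_≡_)
open import Relation.Nullary using (¬_)
open import Function.Bundles using (_⇔_; mk⇔)
open import Induction.WellFounded using (WellFounded)
open import Axiom.ExcludedMiddle using (ExcludedMiddle)
open import Axiom.DoubleNegationElimination using (em⇒dne)
open import Level using (0ℓ)

module ProofInduction {S I : Set} {rule : I → Rule S} where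

  proofInduction : (P : ∀ {s} → Proof rule s → Set) →
                   (∀ i ss {s} (e : rule i ss ≡ just s) (ps : All (Proof rule) ss) →
                      (∀ k → P (nth ps k)) → P (node i ss e ps)) →
                   ∀ {s} (p : Proof rule s) → P p
  proofInduction P step (node i ss e ps) = step i ss e ps (subproofs ps)
    where
    subproofs : ∀ {ts} (qs : All (Proof rule) ts) (k : Fin (length ts)) → P (nth qs k)
    subproofs (q ∷ qs) zero    = proofInduction P step q
    subproofs (q ∷ qs) (suc k) = subproofs qs k

module CutFreeness {S : Set} (_≺_ : S → S → Set) {I : Set} (rule : I → Rule S)
                   (major : (i : I) (ss : List S) → Fin (length ss) → Bool) where
  open System _≺_ rule major
  open ProofInduction

  onlyIntro⇒endsWithIntro : ∀ {s} {p : Proof rule s} → OnlyIntro p → EndsWithIntro p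
  onlyIntro⇒endsWithIntro (onlyIntro _ _ _ _ intro _) = intro

  -- A cut ends with a non-introduction rule, so no sub-proof of an
  -- introduction-only proof is a cut.
  onlyIntro⇒cutFree : ∀ {s} {p : Proof rule s} → OnlyIntro p → CutFree p
  onlyIntro⇒cutFree (onlyIntro _ _ _ _ intro _)    (here (notIntro , _))    = notIntro intro
  onlyIntro⇒cutFree (onlyIntro _ _ _ _ _ onlySubs) (there _ _ _ _ k cutIn) =
    onlyIntro⇒cutFree (onlySubs k) cutIn

  cutFree⇒onlyIntro : ExcludedMiddle 0ℓ → ∀ {s} (p : Proof rule s) → CutFree p → OnlyIntro p
  cutFree⇒onlyIntro em = proofInduction (λ p → CutFree p → OnlyIntro p) step
    where
    step : ∀ i ss {s} (e : rule i ss ≡ just s) (ps : All (Proof rule) ss) →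
           (∀ k → CutFree (nth ps k) → OnlyIntro (nth ps k)) →
           CutFree (node i ss e ps) → OnlyIntro (node i ss e ps)
    step i ss e ps ih cutFree = onlyIntro i ss e ps lastIntro onlySubs
      where
      onlySubs : ∀ k → OnlyIntro (nth ps k)
      onlySubs k = ih k (λ cutIn → cutFree (there i ss e ps k cutIn))

      -- If the last rule were not an introduction rule, the node would be a cut.
      notNotIntro : ¬ ¬ IsIntro _≺_ (rule i)
      notNotIntro notIntro =
        cutFree (here (notIntro , λ k _ → onlyIntro⇒endsWithIntro (onlySubs k)))

      lastIntro : IsIntro _≺_ (rule i)
      lastIntro = em⇒dne em notNotIntro

lemma1 : ExcludedMiddle 0ℓ →
         {S : Set} (_≺_ : S → S → Set) → WellFounded _≺_ →
         {I : Set} (rule : I → Rule S)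
         (major : (i : I) (ss : List S) → Fin (length ss) → Bool) →
         {s : S} (p : Proof rule s) →
         System.CutFree _≺_ rule major p ⇔ System.OnlyIntro _≺_ rule major p
lemma1 em _≺_ _ rule major p = mk⇔ (cutFree⇒onlyIntro em p) onlyIntro⇒cutFree
  where open CutFreeness _≺_ rule major
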